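{- Let $(X,\preccurlyeq,s)$ be a Maximum Common Subelement (MCS) Model and let $x_0\in X$ be such that $s(x_0)=\min\{s(x)\mid x\in X\}$. Then: (a) if $x\in X$ satisfies $s(x)=s(x_0)$, then $x=x_0$; (b) $x_0\in cs(X)$, i.e. $x_0\preccurlyeq y$ for every $y\in X$.
   Context: For a partial order $\preccurlyeq$ on a set $X$ and $X'\subseteq X$, the set of common subelements is $cs(X')=\{x\in X: x\preccurlyeq y \text{ for all } y\in X'\}$. A size function on $(X,\preccurlyeq)$ is a function $s:X\to[0,\infty)$ such that (S1) $x_1\preccurlyeq x_2$ implies $s(x_1)\le s(x_2)$, and (S2) $x_1\preccurlyeq x_2$ and $s(x_1)=s(x_2)$ imply $x_1=x_2$. An MCS Model is a triple $(X,\preccurlyeq,s)$ where $\preccurlyeq$ is a partial order on $X$, $s$ is a size function on $(X,\preccurlyeq)$, and: (A1) for all $x_1,x_2\in X$, $cs(\{x_1,x_2\})\neq\emptyset$ and $\{s(x)\mid x\in cs(\{x_1,x_2\})\}$ has a maximum; (A2) for all $x_1,x_2,x\in X$ with $x_1\preccurlyeq x$ and $x_2\preccurlyeq x$, there exists $x_{12}\in cs(\{x_1,x_2\})$ with $s(x)\ge s(x_1)+s(x_2)-s(x_{12})$. -}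

module Defs where

open import Level using (Level; _⊔_; suc)
open import Data.Product using (Σ; ∃; _×_; _,_)
open import Relation.Binary.PropositionalEquality using (_≡_)
open import Relation.Binary.Structures using (IsPartialOrder; IsTotalOrder)
open import Algebra.Structures using (IsAbelianGroup)

-- Abstract stand-in for the real numbers (agda-stdlib has no ℝ):
-- a totally ordered abelian group (ℝ with +, -, 0, ≤ is an instance).
record OrderedAbelianGroup (c ℓ : Level) : Set (suc (c ⊔ ℓ)) where
  infix  4 _≤_
  infixl 6 _+_ _-_
  field
    Carrier        : Set c
    _≤_            : Carrier → Carrier → Set ℓ
    _+_            : Carrier → Carrier → Carrier
    0#             : Carrier
    -_             : Carrier → Carrier
    isTotalOrder   : IsTotalOrder _≡_ _≤_
    isAbelianGroup : IsAbelianGroup _≡_ _+_ 0# -_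
    +-monoˡ-≤      : ∀ {a b} c → a ≤ b → a + c ≤ b + c

  _-_ : Carrier → Carrier → Carrier
  a - b = a + (- b)

module _ {c ℓ a r : Level} (R : OrderedAbelianGroup c ℓ) where
  open OrderedAbelianGroup R

  InCs₂ : {X : Set a} → (X → X → Set r) → X → X → X → Set r
  InCs₂ _≼_ x₁ x₂ x = (x ≼ x₁) × (x ≼ x₂)

  record IsSizeFunction {X : Set a} (_≼_ : X → X → Set r) (s : X → Carrier)
         : Set (a ⊔ r ⊔ c ⊔ ℓ) where
    field
      nonneg : ∀ x → 0# ≤ s x
      S1     : ∀ {x₁ x₂} → x₁ ≼ x₂ → s x₁ ≤ s x₂
      S2     : ∀ {x₁ x₂} → x₁ ≼ x₂ → s x₁ ≡ s x₂ → x₁ ≡ x₂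

  record IsMCSModel {X : Set a} (_≼_ : X → X → Set r) (s : X → Carrier)
         : Set (a ⊔ r ⊔ c ⊔ ℓ) where
    field
      isPartialOrder : IsPartialOrder _≡_ _≼_
      isSize         : IsSizeFunction _≼_ s
      A1-nonempty    : ∀ x₁ x₂ → ∃ λ x → InCs₂ _≼_ x₁ x₂ x
      A1-max         : ∀ x₁ x₂ → ∃ λ m → InCs₂ _≼_ x₁ x₂ m ×
                         (∀ x → InCs₂ _≼_ x₁ x₂ x → s x ≤ s m)
      A2             : ∀ x₁ x₂ x → x₁ ≼ x → x₂ ≼ x →
                         ∃ λ x₁₂ → InCs₂ _≼_ x₁ x₂ x₁₂ ×
                           (s x₁ + s x₂ - s x₁₂ ≤ s x)

module Submission where

open import Defs
open import Level using (Level)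
open import Data.Product using (_×_; _,_)
open import Relation.Binary.PropositionalEquality using (_≡_; sym; subst)
open import Relation.Binary.Structures using (IsTotalOrder)

-- A common subelement of x₀ and y lies below x₀, so by minimality it has the
-- size of x₀ and (S2) makes it equal to x₀; hence x₀ ≼ y. Part (a) then follows
-- from x₀ ≼ x and (S2) once more.

module _ {c ℓ a r : Level} (R : OrderedAbelianGroup c ℓ)
         {X : Set a} {_≼_ : X → X → Set r} {s : X → OrderedAbelianGroup.Carrier R}
         (size : IsSizeFunction R _≼_ s) where

  open OrderedAbelianGroup R using (_≤_; isTotalOrder)
  open IsTotalOrder isTotalOrder using (antisym)
  open IsSizeFunction size

  below-minimal⇒≡ : ∀ {x₀ x} → (∀ y → s x₀ ≤ s y) → x ≼ x₀ → x ≡ x₀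
  below-minimal⇒≡ {x₀} {x} min x≼x₀ = S2 x≼x₀ (antisym (S1 x≼x₀) (min x))

  minimal-size-unique : ∀ {x₀} → (∀ y → x₀ ≼ y) → ∀ x → s x ≡ s x₀ → x ≡ x₀
  minimal-size-unique least x sx≡sx₀ = sym (S2 (least x) (sym sx≡sx₀))

proposition1 : {c ℓ a r : Level} (R : OrderedAbelianGroup c ℓ)
    {X : Set a} (_≼_ : X → X → Set r) (s : X → OrderedAbelianGroup.Carrier R) →
    IsMCSModel R _≼_ s →
    (x₀ : X) → (∀ x → OrderedAbelianGroup._≤_ R (s x₀) (s x)) →
    (∀ x → s x ≡ s x₀ → x ≡ x₀) × (∀ y → x₀ ≼ y)
proposition1 R _≼_ s M x₀ min = minimal-size-unique R isSize x₀-least , x₀-least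
  where
  open IsMCSModel M using (isSize; A1-nonempty)

  x₀-least : ∀ y → x₀ ≼ y
  x₀-least y with A1-nonempty x₀ y
  ... | m , m≼x₀ , m≼y = subst (_≼ y) (below-minimal⇒≡ R isSize min m≼x₀) m≼y
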